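{- Let $f\colon\mathbb{Q}\to\mathbb{Q}$ be an SD map. Then $f(x)=x$ for all $x\in\mathbb{Q}$.
   Context: An SD map on a field $\mathbb{F}$ is a function $f\colon \mathbb{F}\to\mathbb{F}$ such that for all $x \neq y$ in $\mathbb{F}$ one has $f(x)\neq f(y)$ and $f\left(\frac{x+y}{x-y}\right) = \frac{f(x)+f(y)}{f(x)-f(y)}$. -}

module Defs where

open import Data.Rational using (ℚ; _+_; _-_; _÷_; 0ℚ; ≢-nonZero)
open import Data.Rational.Properties using (_≟_)
open import Relation.Binary.PropositionalEquality using (_≡_; _≢_)
open import Relation.Nullary using (yes; no)

-- Total division on ℚ: p ÷₀ q = p / q when q ≠ 0, and (arbitrarily) 0 when q = 0.
-- In the SD-map definition it is only ever applied with a nonzero denominator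
-- (x - y with x ≠ y, and f x - f y with f x ≠ f y, the latter guaranteed by injectivity).
_÷₀_ : ℚ → ℚ → ℚ
p ÷₀ q with q ≟ 0ℚ
... | yes _ = 0ℚ
... | no q≢0 = _÷_ p q {{≢-nonZero q≢0}}

record IsSDMap (f : ℚ → ℚ) : Set where
  field
    injective : ∀ x y → x ≢ y → f x ≢ f y
    sd-eq     : ∀ x y → x ≢ y →
                f ((x + y) ÷₀ (x - y)) ≡ (f x + f y) ÷₀ (f x - f y)

{-# OPTIONS --safe #-}
-- Comparing the SD relation at (1,0), (2,0) and (0,1) shows that f fixes 0, 1 and -1. The pairs
-- (p, 1) and (p·q, q) have the same image (p+1)/(p-1) under (x, y) ↦ (x+y)/(x-y), and
-- s ↦ (s+1)/(s-1) is injective, so f is multiplicative. The pairs (2,1), (3,2), (5,3) together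
-- with f 4 = (f 2)² leave f 2 ∈ {0, -1, 2}, hence f 2 = 2 by injectivity. The pair (k+2, k),
-- with image k+1, then determines f (k+2) from f k = k and f (k+1) = k+1 whenever k ≠ 0, so f
-- fixes ℕ, hence ℤ as f (-x) = - f x, and finally f (n/d)·d = f n = n.
module Submission where

open import Defs
open import Data.Rational using (ℚ)
open import Relation.Binary.PropositionalEquality using (_≡_)

open import Data.Empty using (⊥-elim)
open import Data.Integer.Base as ℤ using (+_; -[1+_])
import Data.Integer.Properties as ℤ
open import Data.Nat.Base as ℕ using (zero; suc)
import Data.Nat.Properties as ℕ
open import Data.Product.Base using (_×_; _,_; proj₁; proj₂)
open import Data.Rational.Base using (mkℚ; 1ℚ; _+_; _-_; _*_; -_; 1/_; 0ℚ; ↥_; ↧_; ≢-nonZero)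
open import Data.Rational.Literals using (fromℤ)
open import Data.Rational.Properties
  using (_≟_; +-0-group; +-inverseʳ; *-assoc; *-identityˡ; *-identityʳ; *-zeroˡ; *-zeroʳ;
         *-inverseˡ; *-inverseʳ; toℚᵘ-injective; toℚᵘ-homo-+; toℚᵘ-homo-*)
open import Data.Rational.Solver using (module +-*-Solver)
import Data.Rational.Unnormalised.Base as ℚᵘ
import Data.Rational.Unnormalised.Properties as ℚᵘ
open import Data.Sum.Base using (_⊎_; inj₁; inj₂; [_,_]′)
open import Function.Base using (_∘_)
open import Relation.Binary.PropositionalEquality
  using (_≢_; refl; sym; trans; cong; cong₂; subst; subst₂; module ≡-Reasoning)
open import Relation.Nullary.Decidable using (yes; no)

open import Algebra.Properties.Group +-0-group
  renaming (x∙y⁻¹≈ε⇒x≈y to p-q≡0⇒p≡q; x≈y⇒x∙y⁻¹≈ε to p≡q⇒p-q≡0)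
  using ()
open +-*-Solver using (solve; _:+_; _:-_; _:*_; :-_; _:=_; con)
open ≡-Reasoning

2ℚ 3ℚ 4ℚ 5ℚ : ℚ
2ℚ = fromℤ (+ 2)
3ℚ = fromℤ (+ 3)
4ℚ = fromℤ (+ 4)
5ℚ = fromℤ (+ 5)

p≢q⇒p-q≢0 : ∀ {p q} → p ≢ q → p - q ≢ 0ℚ
p≢q⇒p-q≢0 {p} {q} p≢q = p≢q ∘ p-q≡0⇒p≡q p q

*-cancelʳ-≢0 : ∀ {p q r} → r ≢ 0ℚ → p * r ≡ q * r → p ≡ q
*-cancelʳ-≢0 {p} {q} {r} r≢0 pr≡qr = begin
  p            ≡⟨ sym (*-*1/-cancel p) ⟩
  p * r * 1/ r ≡⟨ cong (_* 1/ r) pr≡qr ⟩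
  q * r * 1/ r ≡⟨ *-*1/-cancel q ⟩
  q            ∎
  where
  instance _ = ≢-nonZero r≢0
  *-*1/-cancel : ∀ p → p * r * 1/ r ≡ p
  *-*1/-cancel p = trans (*-assoc p r (1/ r)) (trans (cong (p *_) (*-inverseʳ r)) (*-identityʳ p))

p*q≡0⇒p≡0∨q≡0 : ∀ p q → p * q ≡ 0ℚ → p ≡ 0ℚ ⊎ q ≡ 0ℚ
p*q≡0⇒p≡0∨q≡0 p q pq≡0 with q ≟ 0ℚ
... | yes q≡0 = inj₂ q≡0
... | no  q≢0 = inj₁ (*-cancelʳ-≢0 q≢0 (trans pq≡0 (sym (*-zeroˡ q))))

p*q≢0 : ∀ {p q} → p ≢ 0ℚ → q ≢ 0ℚ → p * q ≢ 0ℚ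
p*q≢0 {p} {q} p≢0 q≢0 = [ p≢0 , q≢0 ]′ ∘ p*q≡0⇒p≡0∨q≡0 p q

÷₀-*-cancel : ∀ p {q} → q ≢ 0ℚ → p ÷₀ q * q ≡ p
÷₀-*-cancel p {q} q≢0 with q ≟ 0ℚ
... | yes q≡0 = ⊥-elim (q≢0 q≡0)
... | no  _   =
  trans (*-assoc p (1/ q) q) (trans (cong (p *_) (*-inverseˡ q)) (*-identityʳ p))
  where instance _ = ≢-nonZero q≢0

fromℤ-homo-+ : ∀ i j → fromℤ (i ℤ.+ j) ≡ fromℤ i + fromℤ j
fromℤ-homo-+ i j = toℚᵘ-injective
  (ℚᵘ.≃-trans (ℚᵘ.*≡* cross-multiplied) (ℚᵘ.≃-sym (toℚᵘ-homo-+ (fromℤ i) (fromℤ j))))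
  where
  cross-multiplied : (i ℤ.+ j) ℤ.* + 1 ≡ (i ℤ.* + 1 ℤ.+ j ℤ.* + 1) ℤ.* + 1
  cross-multiplied =
    cong (ℤ._* + 1) (sym (cong₂ ℤ._+_ (ℤ.*-identityʳ i) (ℤ.*-identityʳ j)))

p*↧p≡↥p : ∀ p → p * fromℤ (↧ p) ≡ fromℤ (↥ p)
p*↧p≡↥p p@(mkℚ n d-1 _) = toℚᵘ-injective
  (ℚᵘ.≃-trans (toℚᵘ-homo-* p (fromℤ (↧ p))) (ℚᵘ.*≡* cross-multiplied))
  where
  cross-multiplied : n ℤ.* + suc d-1 ℤ.* + 1 ≡ n ℤ.* + suc (d-1 ℕ.* 1)
  cross-multiplied =
    trans (ℤ.*-identityʳ _) (cong (λ m → n ℤ.* + suc m) (sym (ℕ.*-identityʳ d-1)))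

z*[s-1]≡s+1⇒z*[x-y]≡x+y⇒x≡s*y : ∀ z s x y →
  z * (s - 1ℚ) ≡ s + 1ℚ → z * (x - y) ≡ x + y → x ≡ s * y
z*[s-1]≡s+1⇒z*[x-y]≡x+y⇒x≡s*y z s x y e₁ e₂ =
  p-q≡0⇒p≡q x (s * y) (*-cancelʳ-≢0 {r = 2ℚ} (λ ()) (begin
    (x - s * y) * 2ℚ
      ≡⟨ solve 3 (λ s x y → (x :- s :* y) :* con 2ℚ
                            := (x :- y) :* (s :+ con 1ℚ) :- (s :- con 1ℚ) :* (x :+ y))
               refl s x y ⟩
    (x - y) * (s + 1ℚ) - (s - 1ℚ) * (x + y)
      ≡⟨ cong₂ (λ u v → (x - y) * u - (s - 1ℚ) * v) (sym e₁) (sym e₂) ⟩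
    (x - y) * (z * (s - 1ℚ)) - (s - 1ℚ) * (z * (x - y))
      ≡⟨ solve 4 (λ z s x y → (x :- y) :* (z :* (s :- con 1ℚ)) :- (s :- con 1ℚ) :* (z :* (x :- y))
                              := con 0ℚ :* con 2ℚ)
               refl z s x y ⟩
    0ℚ * 2ℚ ∎))

-- The first two equations give b = (a+1)/(a-1) and c = (a²+1)/(1+2a-a²); substituting into the
-- third leaves 2a(a+1)(a²+1)(a-2) = 0, and k₁, k₂, k₃ record this elimination.
2a[a+1][a²+1][a-2]≡0 : ∀ a b c →
  b * (a - 1ℚ) ≡ a + 1ℚ → c * (b - a) ≡ b + a → a * a * (c - b) ≡ c + b →
  2ℚ * a * (a + 1ℚ) * (a * a + 1ℚ) * (a - 2ℚ) ≡ 0ℚ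
2a[a+1][a²+1][a-2]≡0 a b c e₁ e₂ e₃ = begin
  2ℚ * a * (a + 1ℚ) * (a * a + 1ℚ) * (a - 2ℚ)
    ≡⟨ solve 3 (λ a b c →
         con 2ℚ :* a :* (a :+ con 1ℚ) :* (a :* a :+ con 1ℚ) :* (a :- con 2ℚ)
         := ((a :* a :+ con 1ℚ) :* (b :* (a :- con 1ℚ) :+ a :+ con 1ℚ)
              :- (a :* a :* a :+ a :* a :+ a :- con 1ℚ) :* (a :- con 1ℚ))
              :* (b :* (a :- con 1ℚ) :- (a :+ con 1ℚ))
            :+ (:- (a :- con 1ℚ) :* (a :- con 1ℚ) :* (a :* a :- con 1ℚ))
              :* (c :* (b :- a) :- (b :+ a))
            :+ ((a :- con 1ℚ) :* (a :- con 1ℚ) :* (b :- a))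
              :* (a :* a :* (c :- b) :- (c :+ b)))
       refl a b c ⟩
  k₁ * (b * (a - 1ℚ) - (a + 1ℚ)) + k₂ * (c * (b - a) - (b + a))
    + k₃ * (a * a * (c - b) - (c + b))
    ≡⟨ cong₂ _+_ (cong₂ _+_ (cong (k₁ *_) (p≡q⇒p-q≡0 e₁)) (cong (k₂ *_) (p≡q⇒p-q≡0 e₂)))
                 (cong (k₃ *_) (p≡q⇒p-q≡0 e₃)) ⟩
  k₁ * 0ℚ + k₂ * 0ℚ + k₃ * 0ℚ
    ≡⟨ solve 3 (λ k₁ k₂ k₃ → k₁ :* con 0ℚ :+ k₂ :* con 0ℚ :+ k₃ :* con 0ℚ := con 0ℚ)
               refl k₁ k₂ k₃ ⟩
  0ℚ ∎
  where
  k₁ k₂ k₃ : ℚ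
  k₁ = (a * a + 1ℚ) * (b * (a - 1ℚ) + a + 1ℚ)
       - (a * a * a + a * a + a - 1ℚ) * (a - 1ℚ)
  k₂ = - (a - 1ℚ) * (a - 1ℚ) * (a * a - 1ℚ)
  k₃ = (a - 1ℚ) * (a - 1ℚ) * (b - a)

module SDMap {f : ℚ → ℚ} (sd : IsSDMap f) where
  open IsSDMap sd

  Fixed : ℚ → Set
  Fixed x = f x ≡ x

  sd-eq′ : ∀ {x y} z → x ≢ y → z * (x - y) ≡ x + y → f z * (f x - f y) ≡ f x + f y
  sd-eq′ {x} {y} z x≢y z[x-y]≡x+y = begin
    f z * (f x - f y)
      ≡⟨ cong (λ w → f w * (f x - f y)) z≡[x+y]÷₀[x-y] ⟩
    f ((x + y) ÷₀ (x - y)) * (f x - f y)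
      ≡⟨ cong (_* (f x - f y)) (sd-eq x y x≢y) ⟩
    (f x + f y) ÷₀ (f x - f y) * (f x - f y)
      ≡⟨ ÷₀-*-cancel (f x + f y) (p≢q⇒p-q≢0 (injective x y x≢y)) ⟩
    f x + f y ∎
    where
    z≡[x+y]÷₀[x-y] : z ≡ (x + y) ÷₀ (x - y)
    z≡[x+y]÷₀[x-y] = *-cancelʳ-≢0 (p≢q⇒p-q≢0 x≢y)
      (trans z[x-y]≡x+y (sym (÷₀-*-cancel (x + y) (p≢q⇒p-q≢0 x≢y))))

  sd-eq-with-0 : ∀ {x} → x ≢ 0ℚ → f 1ℚ * (f x - f 0ℚ) ≡ f x + f 0ℚ
  sd-eq-with-0 {x} x≢0 =
    sd-eq′ 1ℚ x≢0 (solve 1 (λ x → con 1ℚ :* (x :- con 0ℚ) := x :+ con 0ℚ) refl x)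

  f1≡1 : Fixed 1ℚ
  f1≡1 = *-cancelʳ-≢0 (p≢q⇒p-q≢0 (injective 1ℚ 2ℚ (λ ()))) (begin
    f 1ℚ * (f 1ℚ - f 2ℚ)
      ≡⟨ solve 3 (λ c a t → c :* (c :- t) := c :* (c :- a) :- c :* (t :- a))
               refl (f 1ℚ) (f 0ℚ) (f 2ℚ) ⟩
    f 1ℚ * (f 1ℚ - f 0ℚ) - f 1ℚ * (f 2ℚ - f 0ℚ)
      ≡⟨ cong₂ _-_ (sd-eq-with-0 (λ ())) (sd-eq-with-0 (λ ())) ⟩
    (f 1ℚ + f 0ℚ) - (f 2ℚ + f 0ℚ)
      ≡⟨ solve 3 (λ c a t → (c :+ a) :- (t :+ a) := con 1ℚ :* (c :- t))
               refl (f 1ℚ) (f 0ℚ) (f 2ℚ) ⟩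
    1ℚ * (f 1ℚ - f 2ℚ) ∎)

  f0≡0 : Fixed 0ℚ
  f0≡0 = *-cancelʳ-≢0 {r = 2ℚ} (λ ()) (begin
    f 0ℚ * 2ℚ
      ≡⟨ solve 1 (λ a → a :* con 2ℚ := (con 1ℚ :+ a) :- con 1ℚ :* (con 1ℚ :- a))
               refl (f 0ℚ) ⟩
    (1ℚ + f 0ℚ) - 1ℚ * (1ℚ - f 0ℚ)
      ≡⟨ cong (λ c → (c + f 0ℚ) - c * (c - f 0ℚ)) (sym f1≡1) ⟩
    (f 1ℚ + f 0ℚ) - f 1ℚ * (f 1ℚ - f 0ℚ)
      ≡⟨ cong (_-_ (f 1ℚ + f 0ℚ)) (sd-eq-with-0 (λ ())) ⟩
    (f 1ℚ + f 0ℚ) - (f 1ℚ + f 0ℚ)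
      ≡⟨ +-inverseʳ (f 1ℚ + f 0ℚ) ⟩
    0ℚ * 2ℚ ∎)

  f[-1]≡-1 : Fixed (- 1ℚ)
  f[-1]≡-1 = *-cancelʳ-≢0 {r = - 1ℚ} (λ ()) (begin
    f (- 1ℚ) * (- 1ℚ)        ≡⟨ cong₂ (λ a c → f (- 1ℚ) * (a - c)) (sym f0≡0) (sym f1≡1) ⟩
    f (- 1ℚ) * (f 0ℚ - f 1ℚ) ≡⟨ sd-eq′ (- 1ℚ) (λ ()) refl ⟩
    f 0ℚ + f 1ℚ              ≡⟨ cong₂ _+_ f0≡0 f1≡1 ⟩
    - 1ℚ * - 1ℚ              ∎)

  f-homo-*-≢ : ∀ {p q} → p ≢ 1ℚ → q ≢ 0ℚ → f (p * q) ≡ f p * f q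
  f-homo-*-≢ {p} {q} p≢1 q≢0 =
    z*[s-1]≡s+1⇒z*[x-y]≡x+y⇒x≡s*y (f z) (f p) (f (p * q)) (f q)
      (subst (λ c → f z * (f p - c) ≡ f p + c) f1≡1 (sd-eq′ z p≢1 z[p-1]≡p+1))
      (sd-eq′ z pq≢q z[pq-q]≡pq+q)
    where
    z : ℚ
    z = (p + 1ℚ) ÷₀ (p - 1ℚ)
    z[p-1]≡p+1 : z * (p - 1ℚ) ≡ p + 1ℚ
    z[p-1]≡p+1 = ÷₀-*-cancel (p + 1ℚ) (p≢q⇒p-q≢0 p≢1)
    pq≢q : p * q ≢ q
    pq≢q pq≡q = p≢1 (*-cancelʳ-≢0 q≢0 (trans pq≡q (sym (*-identityˡ q))))
    z[pq-q]≡pq+q : z * (p * q - q) ≡ p * q + q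
    z[pq-q]≡pq+q = begin
      z * (p * q - q)
        ≡⟨ solve 3 (λ z p q → z :* (p :* q :- q) := z :* (p :- con 1ℚ) :* q) refl z p q ⟩
      z * (p - 1ℚ) * q
        ≡⟨ cong (_* q) z[p-1]≡p+1 ⟩
      (p + 1ℚ) * q
        ≡⟨ solve 2 (λ p q → (p :+ con 1ℚ) :* q := p :* q :+ q) refl p q ⟩
      p * q + q ∎

  f-homo-* : ∀ p q → f (p * q) ≡ f p * f q
  f-homo-* p q with p ≟ 1ℚ | q ≟ 0ℚ
  ... | yes refl | _        = begin
    f (1ℚ * q)   ≡⟨ cong f (*-identityˡ q) ⟩
    f q          ≡⟨ sym (*-identityˡ (f q)) ⟩
    1ℚ * f q     ≡⟨ cong (_* f q) (sym f1≡1) ⟩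
    f 1ℚ * f q   ∎
  ... | no _     | yes refl = begin
    f (p * 0ℚ)   ≡⟨ cong f (*-zeroʳ p) ⟩
    f 0ℚ         ≡⟨ f0≡0 ⟩
    0ℚ           ≡⟨ sym (*-zeroʳ (f p)) ⟩
    f p * 0ℚ     ≡⟨ cong (f p *_) (sym f0≡0) ⟩
    f p * f 0ℚ   ∎
  ... | no p≢1   | no q≢0   = f-homo-*-≢ p≢1 q≢0

  f-odd : ∀ p → f (- p) ≡ - f p
  f-odd p = begin
    f (- p)              ≡⟨ cong f (solve 1 (λ p → :- p := con (- 1ℚ) :* p) refl p) ⟩
    f (- 1ℚ * p)         ≡⟨ f-homo-* (- 1ℚ) p ⟩
    f (- 1ℚ) * f p       ≡⟨ cong (_* f p) f[-1]≡-1 ⟩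
    - 1ℚ * f p           ≡⟨ solve 1 (λ a → con (- 1ℚ) :* a := :- a) refl (f p) ⟩
    - f p                ∎

  f2≡2 : Fixed 2ℚ
  f2≡2 = [ ⊥-elim ∘ 2a[a+1][a²+1]≢0 , p-q≡0⇒p≡q a 2ℚ ]′
    (p*q≡0⇒p≡0∨q≡0 _ _ (2a[a+1][a²+1][a-2]≡0 a b c e₁ e₂ e₃))
    where
    a b c : ℚ
    a = f 2ℚ
    b = f 3ℚ
    c = f 5ℚ
    e₁ : b * (a - 1ℚ) ≡ a + 1ℚ
    e₁ = subst (λ d → b * (a - d) ≡ a + d) f1≡1 (sd-eq′ 3ℚ (λ ()) refl)
    e₂ : c * (b - a) ≡ b + a
    e₂ = sd-eq′ 5ℚ (λ ()) refl
    f4≡a*a : f 4ℚ ≡ a * a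
    f4≡a*a = f-homo-* 2ℚ 2ℚ
    e₃ : a * a * (c - b) ≡ c + b
    e₃ = subst (λ d → d * (c - b) ≡ c + b) f4≡a*a (sd-eq′ 4ℚ (λ ()) refl)
    a≢0 : a ≢ 0ℚ
    a≢0 a≡0 = injective 2ℚ 0ℚ (λ ()) (trans a≡0 (sym f0≡0))
    f+1≢0 : ∀ x → x ≢ - 1ℚ → f x + 1ℚ ≢ 0ℚ
    f+1≢0 x x≢-1 fx+1≡0 =
      injective x (- 1ℚ) x≢-1 (trans (p-q≡0⇒p≡q (f x) (- 1ℚ) fx+1≡0) (sym f[-1]≡-1))
    a²+1≢0 : a * a + 1ℚ ≢ 0ℚ
    a²+1≢0 = subst (λ d → d + 1ℚ ≢ 0ℚ) f4≡a*a (f+1≢0 4ℚ (λ ()))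
    2a[a+1][a²+1]≢0 : 2ℚ * a * (a + 1ℚ) * (a * a + 1ℚ) ≢ 0ℚ
    2a[a+1][a²+1]≢0 = p*q≢0 (p*q≢0 (p*q≢0 {2ℚ} (λ ()) a≢0) (f+1≢0 2ℚ (λ ()))) a²+1≢0

  f-fixes-2+ : ∀ {k} → k ≢ 0ℚ → Fixed k → Fixed (1ℚ + k) → Fixed (2ℚ + k)
  f-fixes-2+ {k} k≢0 fk≡k fk+1≡k+1 = *-cancelʳ-≢0 k≢0 (begin
    t * k
      ≡⟨ solve 2 (λ t k → t :* k := (con 1ℚ :+ k) :* (t :- k) :- (t :+ k) :+ (con 2ℚ :+ k) :* k)
               refl t k ⟩
    (1ℚ + k) * (t - k) - (t + k) + (2ℚ + k) * k
      ≡⟨ cong (λ e → e - (t + k) + (2ℚ + k) * k) sd-at-k ⟩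
    (t + k) - (t + k) + (2ℚ + k) * k
      ≡⟨ solve 2 (λ t k → (t :+ k) :- (t :+ k) :+ (con 2ℚ :+ k) :* k := (con 2ℚ :+ k) :* k)
               refl t k ⟩
    (2ℚ + k) * k ∎)
    where
    t : ℚ
    t = f (2ℚ + k)
    2+k≢k : 2ℚ + k ≢ k
    2+k≢k 2+k≡k =
      2≢0 (trans (solve 1 (λ k → con 2ℚ := (con 2ℚ :+ k) :- k) refl k) (p≡q⇒p-q≡0 2+k≡k))
      where
      2≢0 : 2ℚ ≢ 0ℚ
      2≢0 ()
    sd-at-k : (1ℚ + k) * (t - k) ≡ t + k
    sd-at-k = subst₂ (λ u v → u * (t - v) ≡ t + v) fk+1≡k+1 fk≡k
      (sd-eq′ (1ℚ + k) 2+k≢k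
        (solve 1 (λ k → (con 1ℚ :+ k) :* ((con 2ℚ :+ k) :- k) := (con 2ℚ :+ k) :+ k) refl k))

  -- Relies on + m ℤ.+ + n reducing to + (m ℕ.+ n).
  fixed-ℕ⁺ : ∀ n → Fixed (fromℤ (+ suc n)) × Fixed (fromℤ (+ suc (suc n)))
  fixed-ℕ⁺ zero    = f1≡1 , f2≡2
  fixed-ℕ⁺ (suc n) with fixed-ℕ⁺ n
  ... | fixed-k , fixed-1+k = fixed-1+k , subst Fixed (sym (fromℤ-homo-+ (+ 2) (+ suc n)))
    (f-fixes-2+ (λ ()) fixed-k (subst Fixed (fromℤ-homo-+ (+ 1) (+ suc n)) fixed-1+k))

  fixed-ℤ : ∀ i → Fixed (fromℤ i)
  fixed-ℤ (+ zero)   = f0≡0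
  fixed-ℤ (+ suc n)  = proj₁ (fixed-ℕ⁺ n)
  -- - fromℤ (+ suc n) and fromℤ -[1+ n ] are definitionally equal.
  fixed-ℤ -[1+ n ]   = trans (f-odd (fromℤ (+ suc n))) (cong -_ (fixed-ℤ (+ suc n)))

theorem3p1 : (f : ℚ → ℚ) → IsSDMap f → ∀ x → f x ≡ x
theorem3p1 f sd p = *-cancelʳ-≢0 {r = fromℤ (↧ p)} (λ ()) (begin
  f p * fromℤ (↧ p)       ≡⟨ cong (f p *_) (sym (fixed-ℤ (↧ p))) ⟩
  f p * f (fromℤ (↧ p))   ≡⟨ sym (f-homo-* p (fromℤ (↧ p))) ⟩
  f (p * fromℤ (↧ p))     ≡⟨ cong f (p*↧p≡↥p p) ⟩
  f (fromℤ (↥ p))         ≡⟨ fixed-ℤ (↥ p) ⟩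
  fromℤ (↥ p)             ≡⟨ sym (p*↧p≡↥p p) ⟩
  p * fromℤ (↧ p)         ∎)
  where open SDMap sd
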